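{- Let $n\ge 4$ and $i$ be integers with $\mathcal{C}_n^i\neq\emptyset$. Then: (i) $\mathcal{C}_{n-1}^{i-1}=\mathcal{C}_{n-2}^{i-1}=\emptyset$ and $\mathcal{C}_{n-3}^{i-1}\neq\emptyset$ if and only if $n=3k$ and $i=k$ for some positive integer $k$; (ii) $\mathcal{C}_{n-2}^{i-1}=\mathcal{C}_{n-3}^{i-1}=\emptyset$ and $\mathcal{C}_{n-1}^{i-1}\neq\emptyset$ if and only if $i=n$; (iii) $\mathcal{C}_{n-1}^{i-1}=\emptyset$, $\mathcal{C}_{n-2}^{i-1}\neq\emptyset$ and $\mathcal{C}_{n-3}^{i-1}\neq\emptyset$ if and only if $n=3k+2$ and $i=\lceil\frac{3k+2}{3}\rceil$ for some positive integer $k$; (iv) $\mathcal{C}_{n-1}^{i-1}\neq\emptyset$, $\mathcal{C}_{n-2}^{i-1}\neq\emptyset$ and $\mathcal{C}_{n-3}^{i-1}=\emptyset$ if and only if $i=n-1$; (v) $\mathcal{C}_{n-1}^{i-1}\neq\emptyset$, $\mathcal{C}_{n-2}^{i-1}\neq\emptyset$ and $\mathcal{C}_{n-3}^{i-1}\neq\emptyset$ if and only if $\lceil\frac{n-1}{3}\rceil+1\le i\le n-2$.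
   Context: For an integer $m\ge 3$, $C_m$ denotes the cycle with vertex set $[m]=\{1,2,\dots,m\}$ and edge set $\{\{1,2\},\{2,3\},\dots,\{m-1,m\},\{m,1\}\}$; by convention $C_1$ is the graph with the single vertex $1$, and $C_2$ is the graph on $\{1,2\}$ with the single edge $\{1,2\}$. A set $S$ of vertices of a graph $G$ is a dominating set if every vertex not in $S$ is adjacent to at least one vertex of $S$. For $m\ge1$ and an integer $j$, $\mathcal{C}_m^j$ denotes the family of dominating sets of $C_m$ of cardinality $j$ (so it is empty if $j<0$ or $j>m$). $\lceil x\rceil$ is the least integer $\ge x$. -}

module Defs where

open import Data.Nat using (ℕ; zero; suc; _+_; _*_; _∸_; _≤_)
open import Data.Nat.DivMod using (_/_)
open import Data.Fin using (Fin; toℕ)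
open import Data.Fin.Subset using (Subset; _∈_; _∉_; ∣_∣)
open import Data.Integer using (ℤ; +_)
open import Data.Product using (Σ; _×_; ∃)
open import Data.Sum using (_⊎_)
open import Relation.Binary.PropositionalEquality using (_≡_)
open import Relation.Nullary using (¬_)

-- Vertices of C_m are Fin m = {0,…,m-1}; vertex k of Fin m stands for vertex k+1 of [m].
-- Edges: {k, k+1} for consecutive labels, plus the wrap-around edge {m-1, 0}
-- (i.e. {m,1} in the paper's labelling) which exists only when m ≥ 3.
-- Thus C_1 has no edge and C_2 has the single edge {0,1}.
CycleAdj : (m : ℕ) → Fin m → Fin m → Set
CycleAdj m u v =
  (toℕ v ≡ suc (toℕ u)) ⊎ (toℕ u ≡ suc (toℕ v))
  ⊎ (3 ≤ m × ((toℕ u ≡ 0 × suc (toℕ v) ≡ m) ⊎ (toℕ v ≡ 0 × suc (toℕ u) ≡ m)))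

IsDominating : (m : ℕ) → Subset m → Set
IsDominating m S = ∀ (v : Fin m) → v ∉ S → Σ (Fin m) (λ u → u ∈ S × CycleAdj m u v)

DomFamNonempty : (m : ℕ) → ℤ → Set
DomFamNonempty m j = Σ (Subset m) (λ S → IsDominating m S × (+ ∣ S ∣ ≡ j))

DomFamEmpty : (m : ℕ) → ℤ → Set
DomFamEmpty m j = ¬ DomFamNonempty m j

⌈_/3⌉ : ℕ → ℕ
⌈ a /3⌉ = (a + 2) / 3

-- A set S dominates the cycle C_m exactly when S, the rotation of S by one step to the left and
-- the rotation by one step to the right together cover all m vertices; the two rotations have |S|
-- elements, so m ≤ 3|S|.  Conversely, whenever j ≤ m ≤ 3j, C_m has a dominating set of size j,
-- obtained by concatenating j blocks 1, 10 and 010 (1 marking a chosen vertex): already the path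
-- on m vertices is dominated.  Hence 𝒞_m^j ≠ ∅ iff ⌈m/3⌉ ≤ j ≤ m, and with i = t + 1 and n ≥ 4 the
-- five parts become linear arithmetic in n and t, using n ≤ 3i and i ≤ n from 𝒞_n^i ≠ ∅.
module Submission where

module CycleDomination where

  open import Defs
  open import Data.Empty using (⊥-elim)
  open import Data.Fin using (Fin; toℕ) renaming (zero to fzero; suc to fsuc)
  open import Data.Fin.Subset using (Subset; inside; outside; _∈_; _∉_; ∣_∣; _∪_; ⊤; _⊆_)
  open import Data.Fin.Subset.Properties using (_∈?_; ∈⊤; ∣⊤∣≡n; ∣p∣≤n; p⊆q⇒∣p∣≤∣q∣; x∈p∪q⁺)
  open import Data.Integer using (+_; +≤+)
  import Data.Integer as ℤ
  open import Data.Integer.Properties using (+-injective; drop‿+≤+)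
  open import Data.Nat using (ℕ; zero; suc; _+_; _*_; _≤_; _<_; z≤n; s≤s)
  open import Data.Nat.DivMod using (m/n≡1+[m∸n]/n)
  open import Data.Nat.Properties
  open import Data.Product using (∃; Σ; _×_; _,_; proj₁; proj₂)
  open import Data.Sum using (_⊎_; inj₁; inj₂)
  open import Data.Vec using (Vec; []; _∷_; here; there; _∷ʳ_; lookup; init; last; initLast)
  open import Data.Vec.Properties using ([]=⇒lookup; lookup⇒[]=)
  open import Function.Bundles using (_⇔_; mk⇔)
  open import Relation.Binary.PropositionalEquality
    using (_≡_; refl; sym; trans; cong; cong₂; subst; module ≡-Reasoning)
  open import Relation.Nullary using (yes; no)

  rotateˡ : ∀ {a} {A : Set a} {n} → Vec A (suc n) → Vec A (suc n)
  rotateˡ (x ∷ xs) = xs ∷ʳ x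

  rotateʳ : ∀ {a} {A : Set a} {n} → Vec A (suc n) → Vec A (suc n)
  rotateʳ xs = last xs ∷ init xs

  rotateˡ-rotateʳ : ∀ {a} {A : Set a} {n} (xs : Vec A (suc n)) → rotateˡ (rotateʳ xs) ≡ xs
  rotateˡ-rotateʳ xs = sym (proj₂ (proj₂ (initLast xs)))

  lookup-∷ʳ-last : ∀ {a} {A : Set a} {n} (xs : Vec A n) x (v : Fin (suc n)) →
                   toℕ v ≡ n → lookup (xs ∷ʳ x) v ≡ x
  lookup-∷ʳ-last []       x fzero    _ = refl
  lookup-∷ʳ-last (y ∷ xs) x (fsuc v) e = lookup-∷ʳ-last xs x v (suc-injective e)

  lookup-∷ʳ-init : ∀ {a} {A : Set a} {n} (xs : Vec A n) x (v : Fin (suc n)) (j : Fin n) →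
                   toℕ v ≡ toℕ j → lookup (xs ∷ʳ x) v ≡ lookup xs j
  lookup-∷ʳ-init (y ∷ xs) x fzero    fzero    _ = refl
  lookup-∷ʳ-init (y ∷ xs) x (fsuc v) (fsuc j) e = lookup-∷ʳ-init xs x v j (suc-injective e)

  ∣p∷ʳx∣≡∣x∷p∣ : ∀ {n} x (p : Subset n) → ∣ p ∷ʳ x ∣ ≡ ∣ x ∷ p ∣
  ∣p∷ʳx∣≡∣x∷p∣ x       []            = refl
  ∣p∷ʳx∣≡∣x∷p∣ x       (outside ∷ p) = ∣p∷ʳx∣≡∣x∷p∣ x p
  ∣p∷ʳx∣≡∣x∷p∣ outside (inside ∷ p)  = cong suc (∣p∷ʳx∣≡∣x∷p∣ outside p)
  ∣p∷ʳx∣≡∣x∷p∣ inside  (inside ∷ p)  = cong suc (∣p∷ʳx∣≡∣x∷p∣ inside p)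

  ∣rotateˡp∣≡∣p∣ : ∀ {n} (p : Subset (suc n)) → ∣ rotateˡ p ∣ ≡ ∣ p ∣
  ∣rotateˡp∣≡∣p∣ (x ∷ p) = ∣p∷ʳx∣≡∣x∷p∣ x p

  ∣rotateʳp∣≡∣p∣ : ∀ {n} (p : Subset (suc n)) → ∣ rotateʳ p ∣ ≡ ∣ p ∣
  ∣rotateʳp∣≡∣p∣ p = trans (sym (∣rotateˡp∣≡∣p∣ (rotateʳ p))) (cong ∣_∣ (rotateˡ-rotateʳ p))

  ∣p∪q∣≤∣p∣+∣q∣ : ∀ {n} (p q : Subset n) → ∣ p ∪ q ∣ ≤ ∣ p ∣ + ∣ q ∣
  ∣p∪q∣≤∣p∣+∣q∣ []            []            = z≤n
  ∣p∪q∣≤∣p∣+∣q∣ (outside ∷ p) (outside ∷ q) = ∣p∪q∣≤∣p∣+∣q∣ p q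
  ∣p∪q∣≤∣p∣+∣q∣ (outside ∷ p) (inside ∷ q)  =
    ≤-trans (s≤s (∣p∪q∣≤∣p∣+∣q∣ p q)) (≤-reflexive (sym (+-suc ∣ p ∣ ∣ q ∣)))
  ∣p∪q∣≤∣p∣+∣q∣ (inside ∷ p)  (outside ∷ q) = s≤s (∣p∪q∣≤∣p∣+∣q∣ p q)
  ∣p∪q∣≤∣p∣+∣q∣ (inside ∷ p)  (inside ∷ q)  =
    s≤s (≤-trans (∣p∪q∣≤∣p∣+∣q∣ p q) (+-monoʳ-≤ ∣ p ∣ (n≤1+n ∣ q ∣)))

  CycleSucc : (m : ℕ) → Fin m → Fin m → Set
  CycleSucc m v u = toℕ u ≡ suc (toℕ v) ⊎ (toℕ u ≡ 0 × suc (toℕ v) ≡ m)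

  cycleAdj⇒cycleSucc : ∀ {m} {u v : Fin m} → CycleAdj m u v → CycleSucc m v u ⊎ CycleSucc m u v
  cycleAdj⇒cycleSucc (inj₁ v≡u+1)                   = inj₂ (inj₁ v≡u+1)
  cycleAdj⇒cycleSucc (inj₂ (inj₁ u≡v+1))            = inj₁ (inj₁ u≡v+1)
  cycleAdj⇒cycleSucc (inj₂ (inj₂ (_ , inj₁ wrap)))  = inj₁ (inj₂ wrap)
  cycleAdj⇒cycleSucc (inj₂ (inj₂ (_ , inj₂ wrap)))  = inj₂ (inj₂ wrap)

  lookup-rotateˡ : ∀ {a} {A : Set a} {n} (xs : Vec A (suc n)) {u v} →
                   CycleSucc (suc n) v u → lookup (rotateˡ xs) v ≡ lookup xs u
  lookup-rotateˡ (x ∷ xs) {fsuc u} (inj₁ u≡v+1)     = lookup-∷ʳ-init xs x _ u (sym (suc-injective u≡v+1))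
  lookup-rotateˡ (x ∷ xs) {fzero}  (inj₂ (_ , v≡n)) = lookup-∷ʳ-last xs x _ (suc-injective v≡n)

  ∈-rotateˡ : ∀ {n} (p : Subset (suc n)) {u v} → CycleSucc (suc n) v u → u ∈ p → v ∈ rotateˡ p
  ∈-rotateˡ p {u} {v} succ u∈p =
    lookup⇒[]= v (rotateˡ p) (trans (lookup-rotateˡ p succ) ([]=⇒lookup u∈p))

  ∈-rotateʳ : ∀ {n} (p : Subset (suc n)) {u v} → CycleSucc (suc n) u v → u ∈ p → v ∈ rotateʳ p
  ∈-rotateʳ p {u} {v} succ u∈p = lookup⇒[]= v (rotateʳ p) (begin
    lookup (rotateʳ p) v           ≡⟨ sym (lookup-rotateˡ (rotateʳ p) succ) ⟩
    lookup (rotateˡ (rotateʳ p)) u ≡⟨ cong (λ q → lookup q u) (rotateˡ-rotateʳ p) ⟩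
    lookup p u                     ≡⟨ []=⇒lookup u∈p ⟩
    inside                         ∎)
    where open ≡-Reasoning

  dominating⇒covering : ∀ {n} (S : Subset (suc n)) → IsDominating (suc n) S →
                        ⊤ ⊆ S ∪ (rotateˡ S ∪ rotateʳ S)
  dominating⇒covering S dom {v} _ with v ∈? S
  ... | yes v∈S = x∈p∪q⁺ (inj₁ v∈S)
  ... | no  v∉S with dom v v∉S
  ...   | u , u∈S , adj with cycleAdj⇒cycleSucc adj
  ...     | inj₁ succ = x∈p∪q⁺ (inj₂ (x∈p∪q⁺ (inj₁ (∈-rotateˡ S succ u∈S))))
  ...     | inj₂ succ = x∈p∪q⁺ (inj₂ (x∈p∪q⁺ (inj₂ (∈-rotateʳ S succ u∈S))))

  dominating⇒m≤3∣S∣ : ∀ m (S : Subset m) → IsDominating m S → m ≤ 3 * ∣ S ∣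
  dominating⇒m≤3∣S∣ zero    S dom = z≤n
  dominating⇒m≤3∣S∣ (suc n) S dom = begin
    suc n                                   ≡⟨ sym (∣⊤∣≡n (suc n)) ⟩
    ∣ ⊤ {suc n} ∣                           ≤⟨ p⊆q⇒∣p∣≤∣q∣ (dominating⇒covering S dom) ⟩
    ∣ S ∪ (rotateˡ S ∪ rotateʳ S) ∣         ≤⟨ ∣p∪q∣≤∣p∣+∣q∣ S _ ⟩
    ∣ S ∣ + ∣ rotateˡ S ∪ rotateʳ S ∣       ≤⟨ +-monoʳ-≤ ∣ S ∣ (∣p∪q∣≤∣p∣+∣q∣ (rotateˡ S) _) ⟩
    ∣ S ∣ + (∣ rotateˡ S ∣ + ∣ rotateʳ S ∣) ≡⟨ cong₂ (λ a b → ∣ S ∣ + (a + b))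
                                                      (∣rotateˡp∣≡∣p∣ S) (∣rotateʳp∣≡∣p∣ S) ⟩
    ∣ S ∣ + (∣ S ∣ + ∣ S ∣)                  ≡⟨ cong (λ a → ∣ S ∣ + (∣ S ∣ + a)) (sym (+-identityʳ ∣ S ∣)) ⟩
    3 * ∣ S ∣                               ∎
    where open ≤-Reasoning

  PathAdj : ∀ {m} → Fin m → Fin m → Set
  PathAdj u v = toℕ v ≡ suc (toℕ u) ⊎ toℕ u ≡ suc (toℕ v)

  DominatedIn : ∀ {m} → Subset m → Fin m → Set
  DominatedIn S v = ∃ λ u → u ∈ S × PathAdj u v

  IsPathDominating : ∀ {m} → Subset m → Set
  IsPathDominating S = ∀ v → v ∉ S → DominatedIn S v

  pathDominating⇒dominating : ∀ {m} {S : Subset m} → IsPathDominating S → IsDominating m S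
  pathDominating⇒dominating pd v v∉S with pd v v∉S
  ... | u , u∈S , inj₁ v≡u+1 = u , u∈S , inj₁ v≡u+1
  ... | u , u∈S , inj₂ u≡v+1 = u , u∈S , inj₂ (inj₁ u≡v+1)

  dominatedIn-∷ : ∀ {m} {S : Subset m} {v} x → DominatedIn S v → DominatedIn (x ∷ S) (fsuc v)
  dominatedIn-∷ x (u , u∈S , inj₁ v≡u+1) = fsuc u , there u∈S , inj₁ (cong suc v≡u+1)
  dominatedIn-∷ x (u , u∈S , inj₂ u≡v+1) = fsuc u , there u∈S , inj₂ (cong suc u≡v+1)

  ⊤-pathDominating : ∀ {m} → IsPathDominating (⊤ {m})
  ⊤-pathDominating v v∉⊤ = ⊥-elim (v∉⊤ ∈⊤)

  inside∷outside∷-pathDominating : ∀ {m} {S : Subset m} →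
                                   IsPathDominating S → IsPathDominating (inside ∷ outside ∷ S)
  inside∷outside∷-pathDominating pd fzero           v∉S = ⊥-elim (v∉S here)
  inside∷outside∷-pathDominating pd (fsuc fzero)    v∉S = fzero , here , inj₁ refl
  inside∷outside∷-pathDominating pd (fsuc (fsuc v)) v∉S =
    dominatedIn-∷ inside (dominatedIn-∷ outside (pd v (λ v∈S → v∉S (there (there v∈S)))))

  outside∷inside∷-pathDominating : ∀ {m} {S : Subset m} →
                                   IsPathDominating (inside ∷ S) → IsPathDominating (outside ∷ inside ∷ S)
  outside∷inside∷-pathDominating pd fzero    v∉S = fsuc fzero , there here , inj₂ refl
  outside∷inside∷-pathDominating pd (fsuc v) v∉S = dominatedIn-∷ outside (pd v (λ v∈S → v∉S (there v∈S)))

  PathDominatingSetOfSize : ℕ → ℕ → Set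
  PathDominatingSetOfSize m j = Σ (Subset m) λ S → IsPathDominating S × ∣ S ∣ ≡ j

  prepend-010 : ∀ {m j} → PathDominatingSetOfSize m j → PathDominatingSetOfSize (3 + m) (suc j)
  prepend-010 (S , pd , ∣S∣≡j) =
    outside ∷ inside ∷ outside ∷ S ,
    outside∷inside∷-pathDominating (inside∷outside∷-pathDominating pd) ,
    cong suc ∣S∣≡j

  pathDominatingSetOfSize : ∀ j p → p ≤ j + j → PathDominatingSetOfSize (j + p) j
  pathDominatingSetOfSize j       zero          _ =
    subst (λ m → PathDominatingSetOfSize m j) (sym (+-identityʳ j)) (⊤ , ⊤-pathDominating , ∣⊤∣≡n j)
  pathDominatingSetOfSize (suc j) (suc zero)    _ =
    subst (λ m → PathDominatingSetOfSize m (suc j)) (sym (+-comm (suc j) 1))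
      (inside ∷ outside ∷ ⊤ , inside∷outside∷-pathDominating ⊤-pathDominating , cong suc (∣⊤∣≡n j))
  pathDominatingSetOfSize (suc j) (suc (suc p)) p+2≤2j+2 =
    subst (λ m → PathDominatingSetOfSize m (suc j)) (cong suc (sym j+[p+2]≡2+j+p))
      (prepend-010 (pathDominatingSetOfSize j p p≤2j))
    where
    j+[p+2]≡2+j+p : j + suc (suc p) ≡ suc (suc (j + p))
    j+[p+2]≡2+j+p = trans (+-suc j (suc p)) (cong suc (+-suc j p))
    p≤2j : p ≤ j + j
    p≤2j = ≤-pred (≤-pred (≤-trans p+2≤2j+2 (≤-reflexive (cong suc (+-suc j j)))))

  nonempty⇒bounds : ∀ {m j} → DomFamNonempty m (+ j) → m ≤ 3 * j × j ≤ m
  nonempty⇒bounds {m} (S , dom , refl) = dominating⇒m≤3∣S∣ m S dom , ∣p∣≤n S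

  pathDominating⇒nonempty : ∀ {m j} → PathDominatingSetOfSize m j → DomFamNonempty m (+ j)
  pathDominating⇒nonempty (S , pd , ∣S∣≡j) = S , pathDominating⇒dominating pd , cong +_ ∣S∣≡j

  bounds⇒nonempty : ∀ {m j} → m ≤ 3 * j → j ≤ m → DomFamNonempty m (+ j)
  bounds⇒nonempty {j = j} m≤3j j≤m with m≤n⇒∃[o]m+o≡n j≤m
  ... | p , refl = pathDominating⇒nonempty (pathDominatingSetOfSize j p p≤2j)
    where
    p≤2j : p ≤ j + j
    p≤2j = +-cancelˡ-≤ j p (j + j) (≤-trans m≤3j (≤-reflexive (cong (λ k → j + (j + k)) (+-identityʳ j))))

  empty-if-< : ∀ {m j} → m < j → DomFamEmpty m (+ j)
  empty-if-< m<j ne = <⇒≱ m<j (proj₂ (nonempty⇒bounds ne))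

  empty-if-3*< : ∀ {m j} → 3 * j < m → DomFamEmpty m (+ j)
  empty-if-3*< 3j<m ne = <⇒≱ 3j<m (proj₁ (nonempty⇒bounds ne))

  empty⇒< : ∀ {m j} → DomFamEmpty m (+ j) → m ≤ 3 * j → m < j
  empty⇒< e m≤3j = ≰⇒> (λ j≤m → e (bounds⇒nonempty m≤3j j≤m))

  empty⇒3*< : ∀ {m j} → DomFamEmpty m (+ j) → j ≤ m → 3 * j < m
  empty⇒3*< e j≤m = ≰⇒> (λ m≤3j → e (bounds⇒nonempty m≤3j j≤m))

  ⌈3+a/3⌉≡1+⌈a/3⌉ : ∀ a → ⌈ 3 + a /3⌉ ≡ suc ⌈ a /3⌉
  ⌈3+a/3⌉≡1+⌈a/3⌉ a = m/n≡1+[m∸n]/n {3 + a + 2} (s≤s (s≤s (s≤s z≤n)))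

  ⌈3k+2/3⌉≡1+k : ∀ k → ⌈ 3 * k + 2 /3⌉ ≡ suc k
  ⌈3k+2/3⌉≡1+k zero    = refl
  ⌈3k+2/3⌉≡1+k (suc k) = begin
    ⌈ 3 * suc k + 2 /3⌉   ≡⟨ cong (λ x → ⌈ x + 2 /3⌉) (*-suc 3 k) ⟩
    ⌈ 3 + (3 * k + 2) /3⌉ ≡⟨ ⌈3+a/3⌉≡1+⌈a/3⌉ (3 * k + 2) ⟩
    suc ⌈ 3 * k + 2 /3⌉   ≡⟨ cong suc (⌈3k+2/3⌉≡1+k k) ⟩
    suc (suc k)           ∎
    where open ≡-Reasoning

  ≤3*⇒⌈/3⌉≤ : ∀ a t → a ≤ 3 * t → ⌈ a /3⌉ ≤ t
  ≤3*⇒⌈/3⌉≤ zero                t       _ = z≤n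
  ≤3*⇒⌈/3⌉≤ (suc zero)          (suc t) _ = s≤s z≤n
  ≤3*⇒⌈/3⌉≤ (suc (suc zero))    (suc t) _ = s≤s z≤n
  ≤3*⇒⌈/3⌉≤ (suc (suc (suc a))) (suc t) a+3≤3t+3 rewrite ⌈3+a/3⌉≡1+⌈a/3⌉ a | *-suc 3 t =
    s≤s (≤3*⇒⌈/3⌉≤ a t (≤-pred (≤-pred (≤-pred a+3≤3t+3))))

  ⌈/3⌉≤⇒≤3* : ∀ a t → ⌈ a /3⌉ ≤ t → a ≤ 3 * t
  ⌈/3⌉≤⇒≤3* zero                t       _ = z≤n
  ⌈/3⌉≤⇒≤3* (suc zero)          (suc t) _ = ≤-trans (s≤s z≤n) (*-monoʳ-≤ 3 (s≤s z≤n))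
  ⌈/3⌉≤⇒≤3* (suc (suc zero))    (suc t) _ = ≤-trans (s≤s (s≤s z≤n)) (*-monoʳ-≤ 3 (s≤s z≤n))
  ⌈/3⌉≤⇒≤3* (suc (suc (suc a))) t ⌈a+3/3⌉≤t with subst (_≤ t) (⌈3+a/3⌉≡1+⌈a/3⌉ a) ⌈a+3/3⌉≤t
  ... | s≤s {n = t-1} ⌈a/3⌉≤t-1 =
    subst (3 + a ≤_) (sym (*-suc 3 t-1)) (s≤s (s≤s (s≤s (⌈/3⌉≤⇒≤3* a t-1 ⌈a/3⌉≤t-1))))

  1≤3*n⇒1≤n : ∀ {n} → 1 ≤ 3 * n → 1 ≤ n
  1≤3*n⇒1≤n {suc n} _ = s≤s z≤n

  4+w≤3[1+t]⇒1+w≤3t : ∀ {w t} → 4 + w ≤ 3 * suc t → 1 + w ≤ 3 * t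
  4+w≤3[1+t]⇒1+w≤3t {t = t} 4+w≤3[1+t] =
    ≤-pred (≤-pred (≤-pred (≤-trans 4+w≤3[1+t] (≤-reflexive (*-suc 3 t)))))

  2+n≤3*n : ∀ {n} → 1 ≤ n → 2 + n ≤ 3 * n
  2+n≤3*n {suc n} _ = subst (3 + n ≤_) (sym (*-suc 3 n)) (+-monoʳ-≤ 3 (m≤n*m n 3))

  -- Parts (i)–(v) for n = 4 + w and i = 1 + t; the hypotheses are what is left of n ≤ 3i and i ≤ n.

  lemma4-i : ∀ {w t} → 1 + w ≤ 3 * t →
    (DomFamEmpty (3 + w) (+ t) × DomFamEmpty (2 + w) (+ t) × DomFamNonempty (1 + w) (+ t))
    ⇔ Σ ℕ (λ k → 1 ≤ k × 4 + w ≡ 3 * k × + suc t ≡ + k)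
  lemma4-i {w} {t} 1+w≤3t = mk⇔ to from
    where
    to : DomFamEmpty (3 + w) (+ t) × DomFamEmpty (2 + w) (+ t) × DomFamNonempty (1 + w) (+ t) →
         Σ ℕ (λ k → 1 ≤ k × 4 + w ≡ 3 * k × + suc t ≡ + k)
    to (_ , ¬N₂ , N₃) = suc t , s≤s z≤n , trans (cong (λ x → 3 + x) (sym 3t≡1+w)) (sym (*-suc 3 t)) , refl
      where
      3t≡1+w : 3 * t ≡ 1 + w
      3t≡1+w = ≤-antisym (≤-pred (empty⇒3*< ¬N₂ (m≤n⇒m≤1+n (proj₂ (nonempty⇒bounds N₃))))) 1+w≤3t
    from : Σ ℕ (λ k → 1 ≤ k × 4 + w ≡ 3 * k × + suc t ≡ + k) →
           DomFamEmpty (3 + w) (+ t) × DomFamEmpty (2 + w) (+ t) × DomFamNonempty (1 + w) (+ t)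
    from (k , _ , 4+w≡3k , refl) =
      empty-if-3*< (m≤n⇒m≤1+n 3t<2+w) , empty-if-3*< 3t<2+w ,
      bounds⇒nonempty 1+w≤3t (subst (t ≤_) 3t≡1+w (m≤n*m t 3))
      where
      3t≡1+w : 3 * t ≡ 1 + w
      3t≡1+w = sym (+-cancelˡ-≡ 3 _ _ (trans 4+w≡3k (*-suc 3 t)))
      3t<2+w : 3 * t < 2 + w
      3t<2+w = ≤-reflexive (cong suc 3t≡1+w)

  lemma4-ii : ∀ {w t} → t ≤ 3 + w →
    (DomFamEmpty (2 + w) (+ t) × DomFamEmpty (1 + w) (+ t) × DomFamNonempty (3 + w) (+ t))
    ⇔ (+ suc t ≡ + (4 + w))
  lemma4-ii {w} {t} t≤3+w = mk⇔ to from
    where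
    to : DomFamEmpty (2 + w) (+ t) × DomFamEmpty (1 + w) (+ t) × DomFamNonempty (3 + w) (+ t) →
         + suc t ≡ + (4 + w)
    to (¬N₂ , _ , N₁) =
      cong (λ x → + suc x) (≤-antisym t≤3+w (empty⇒< ¬N₂ (≤-trans (n≤1+n _) (proj₁ (nonempty⇒bounds N₁)))))
    from : + suc t ≡ + (4 + w) →
           DomFamEmpty (2 + w) (+ t) × DomFamEmpty (1 + w) (+ t) × DomFamNonempty (3 + w) (+ t)
    from eq with suc-injective (+-injective eq)
    ... | refl = empty-if-< ≤-refl , empty-if-< (n≤1+n _) , bounds⇒nonempty (m≤n*m _ 3) ≤-refl

  lemma4-iii : ∀ {w t} → t ≤ 3 + w →
    (DomFamEmpty (3 + w) (+ t) × DomFamNonempty (2 + w) (+ t) × DomFamNonempty (1 + w) (+ t))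
    ⇔ Σ ℕ (λ k → 1 ≤ k × 4 + w ≡ 3 * k + 2 × + suc t ≡ + ⌈ 3 * k + 2 /3⌉)
  lemma4-iii {w} {t} t≤3+w = mk⇔ to from
    where
    to : DomFamEmpty (3 + w) (+ t) × DomFamNonempty (2 + w) (+ t) × DomFamNonempty (1 + w) (+ t) →
         Σ ℕ (λ k → 1 ≤ k × 4 + w ≡ 3 * k + 2 × + suc t ≡ + ⌈ 3 * k + 2 /3⌉)
    to (¬N₁ , N₂ , _) = t , 1≤t , 4+w≡3t+2 , cong +_ (sym (⌈3k+2/3⌉≡1+k t))
      where
      3t≡2+w : 3 * t ≡ 2 + w
      3t≡2+w = ≤-antisym (≤-pred (empty⇒3*< ¬N₁ t≤3+w)) (proj₁ (nonempty⇒bounds N₂))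
      4+w≡3t+2 : 4 + w ≡ 3 * t + 2
      4+w≡3t+2 = trans (+-comm 2 (2 + w)) (cong (_+ 2) (sym 3t≡2+w))
      1≤t : 1 ≤ t
      1≤t = 1≤3*n⇒1≤n (≤-trans (s≤s z≤n) (proj₁ (nonempty⇒bounds N₂)))
    from : Σ ℕ (λ k → 1 ≤ k × 4 + w ≡ 3 * k + 2 × + suc t ≡ + ⌈ 3 * k + 2 /3⌉) →
           DomFamEmpty (3 + w) (+ t) × DomFamNonempty (2 + w) (+ t) × DomFamNonempty (1 + w) (+ t)
    from (k , 1≤k , 4+w≡3k+2 , eq)
      with suc-injective (+-injective (trans eq (cong +_ (⌈3k+2/3⌉≡1+k k))))
    ... | refl =
      empty-if-3*< (s≤s (≤-reflexive 3t≡2+w)) ,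
      bounds⇒nonempty (≤-reflexive (sym 3t≡2+w)) (subst (t ≤_) 3t≡2+w (m≤n*m t 3)) ,
      bounds⇒nonempty (≤-trans (n≤1+n _) (≤-reflexive (sym 3t≡2+w))) (m≤n⇒m≤1+n t≤w)
      where
      3t≡2+w : 3 * t ≡ 2 + w
      3t≡2+w = sym (+-cancelʳ-≡ 2 (2 + w) (3 * t) (trans (+-comm (2 + w) 2) 4+w≡3k+2))
      t≤w : t ≤ w
      t≤w = +-cancelˡ-≤ 2 t w (≤-trans (2+n≤3*n 1≤k) (≤-reflexive 3t≡2+w))

  lemma4-iv : ∀ {w t} → 1 + w ≤ 3 * t →
    (DomFamNonempty (3 + w) (+ t) × DomFamNonempty (2 + w) (+ t) × DomFamEmpty (1 + w) (+ t))
    ⇔ (+ suc t ≡ + (3 + w))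
  lemma4-iv {w} {t} 1+w≤3t = mk⇔ to from
    where
    to : DomFamNonempty (3 + w) (+ t) × DomFamNonempty (2 + w) (+ t) × DomFamEmpty (1 + w) (+ t) →
         + suc t ≡ + (3 + w)
    to (_ , N₂ , ¬N₃) = cong (λ x → + suc x) (≤-antisym (proj₂ (nonempty⇒bounds N₂)) (empty⇒< ¬N₃ 1+w≤3t))
    from : + suc t ≡ + (3 + w) →
           DomFamNonempty (3 + w) (+ t) × DomFamNonempty (2 + w) (+ t) × DomFamEmpty (1 + w) (+ t)
    from eq with suc-injective (+-injective eq)
    ... | refl =
      bounds⇒nonempty (≤-trans (n≤1+n _) (2+n≤3*n (s≤s z≤n))) (n≤1+n _) ,
      bounds⇒nonempty (m≤n*m _ 3) ≤-refl ,
      empty-if-< ≤-refl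

  lemma4-v : ∀ {w t} → 1 + w ≤ 3 * t →
    (DomFamNonempty (3 + w) (+ t) × DomFamNonempty (2 + w) (+ t) × DomFamNonempty (1 + w) (+ t))
    ⇔ ((+ ⌈ 3 + w /3⌉ ℤ.+ + 1 ℤ.≤ + suc t) × (+ suc t ℤ.≤ + (2 + w)))
  lemma4-v {w} {t} 1+w≤3t = mk⇔ to from
    where
    to : DomFamNonempty (3 + w) (+ t) × DomFamNonempty (2 + w) (+ t) × DomFamNonempty (1 + w) (+ t) →
         (+ ⌈ 3 + w /3⌉ ℤ.+ + 1 ℤ.≤ + suc t) × (+ suc t ℤ.≤ + (2 + w))
    to (N₁ , _ , N₃) =
      +≤+ (subst (_≤ suc t) (+-comm 1 _) (s≤s (≤3*⇒⌈/3⌉≤ _ t (proj₁ (nonempty⇒bounds N₁))))) ,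
      +≤+ (s≤s (proj₂ (nonempty⇒bounds N₃)))
    from : (+ ⌈ 3 + w /3⌉ ℤ.+ + 1 ℤ.≤ + suc t) × (+ suc t ℤ.≤ + (2 + w)) →
           DomFamNonempty (3 + w) (+ t) × DomFamNonempty (2 + w) (+ t) × DomFamNonempty (1 + w) (+ t)
    from (lower , upper) =
      bounds⇒nonempty 3+w≤3t (m≤n⇒m≤1+n (m≤n⇒m≤1+n t≤1+w)) ,
      bounds⇒nonempty (≤-trans (n≤1+n _) 3+w≤3t) (m≤n⇒m≤1+n t≤1+w) ,
      bounds⇒nonempty 1+w≤3t t≤1+w
      where
      3+w≤3t : 3 + w ≤ 3 * t
      3+w≤3t = ⌈/3⌉≤⇒≤3* _ t (≤-pred (subst (_≤ suc t) (+-comm _ 1) (drop‿+≤+ lower)))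
      t≤1+w : t ≤ 1 + w
      t≤1+w = ≤-pred (drop‿+≤+ upper)

open import Defs
open import Data.Nat using (ℕ; _≤_; _*_; _∸_)
open import Data.Integer using (ℤ; +_; _-_; _+_)
open import Data.Integer as ℤ using ()
open import Data.Product using (Σ; _×_)
open import Function.Bundles using (_⇔_)
open import Relation.Binary.PropositionalEquality using (_≡_)

open import Data.Nat using (suc; s≤s)
open import Data.Fin.Subset using (∣_∣)
open import Data.Fin.Subset.Properties using (∣p∣≤n)
open import Data.Product using (_,_)
open import Relation.Binary.PropositionalEquality using (refl)
open CycleDomination

lemma4 : (n : ℕ) (i : ℤ) → 4 ≤ n → DomFamNonempty n i →
    ((DomFamEmpty (n ∸ 1) (i - + 1) × DomFamEmpty (n ∸ 2) (i - + 1) × DomFamNonempty (n ∸ 3) (i - + 1))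
      ⇔ Σ ℕ (λ k → 1 ≤ k × n ≡ 3 * k × i ≡ + k))
    × ((DomFamEmpty (n ∸ 2) (i - + 1) × DomFamEmpty (n ∸ 3) (i - + 1) × DomFamNonempty (n ∸ 1) (i - + 1))
      ⇔ (i ≡ + n))
    × ((DomFamEmpty (n ∸ 1) (i - + 1) × DomFamNonempty (n ∸ 2) (i - + 1) × DomFamNonempty (n ∸ 3) (i - + 1))
      ⇔ Σ ℕ (λ k → 1 ≤ k × n ≡ 3 * k Data.Nat.+ 2 × i ≡ + ⌈ 3 * k Data.Nat.+ 2 /3⌉))
    × ((DomFamNonempty (n ∸ 1) (i - + 1) × DomFamNonempty (n ∸ 2) (i - + 1) × DomFamEmpty (n ∸ 3) (i - + 1))
      ⇔ (i ≡ + n - + 1))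
    × ((DomFamNonempty (n ∸ 1) (i - + 1) × DomFamNonempty (n ∸ 2) (i - + 1) × DomFamNonempty (n ∸ 3) (i - + 1))
      ⇔ ((+ ⌈ n ∸ 1 /3⌉ + + 1 ℤ.≤ i) × (i ℤ.≤ + n - + 2)))
lemma4 _ _ (s≤s (s≤s (s≤s (s≤s _)))) (S , dom , refl)
  with ∣ S ∣ | dominating⇒m≤3∣S∣ _ S dom | ∣p∣≤n S
... | suc t | 4+w≤3[1+t] | s≤s t≤3+w =
  lemma4-i (4+w≤3[1+t]⇒1+w≤3t 4+w≤3[1+t]) ,
  lemma4-ii t≤3+w ,
  lemma4-iii t≤3+w ,
  lemma4-iv (4+w≤3[1+t]⇒1+w≤3t 4+w≤3[1+t]) ,
  lemma4-v (4+w≤3[1+t]⇒1+w≤3t 4+w≤3[1+t])
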